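{- Let $1\le q\le j$ be integers and $x$ a formal variable. There is a weight-preserving bijection $$[q]\times B((\underbrace{x,\dots,x}_{q+1}),j-q)\;\longleftrightarrow\;[j]\times B((\underbrace{x,\dots,x}_{q}),j-q).$$
   Context: $[k]=\{1,\dots,k\}$, regarded as a set whose elements all have weight $1$. For formal variables $z_1,\dots,z_r$ and an integer $k$, $B((z_1,\dots,z_r),k)$ is the set of tuples $(a_1,\dots,a_r)$ of nonnegative integers with $\sum a_i=k$ (empty if $k<0$), with weight $\prod z_i^{a_i}$. The weight of a pair in a Cartesian product is the product of the weights. A bijection is weight-preserving if each element and its image have the same weight. -}

module Defs where

open import Data.Nat using (ℕ; zero; suc; _+_)
open import Data.Fin using (Fin; _≟_)
open import Data.Vec using (Vec; []; _∷_; replicate; zipWith; tabulate; sum)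
open import Data.Product using (Σ; _×_; _,_)
open import Relation.Binary.PropositionalEquality using (_≡_)
open import Relation.Nullary using (yes; no)
open import Function.Bundles using (_↔_; Inverse)

-- A monomial in the formal variables indexed by Fin m, as its exponent vector.
Mono : ℕ → Set
Mono m = Vec ℕ m

one : ∀ {m} → Mono m
one = replicate _ 0

_·_ : ∀ {m} → Mono m → Mono m → Mono m
_·_ = zipWith _+_

pow : ∀ {m} → Fin m → ℕ → Mono m
pow v a = tabulate (λ u → helper u)
  where
  helper : _ → ℕ
  helper u with u ≟ v
  ... | yes _ = a
  ... | no _ = 0

record WSet (m : ℕ) : Set₁ where
  field
    Carrier : Set
    weight  : Carrier → Mono m
open WSet public

[_] : ∀ {m} → ℕ → WSet m
[ k ] = record { Carrier = Fin k ; weight = λ _ → one }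

tupleWeight : ∀ {m r} → Vec (Fin m) r → Vec ℕ r → Mono m
tupleWeight [] [] = one
tupleWeight (z ∷ zs) (a ∷ as) = pow z a · tupleWeight zs as

B : ∀ {m r} → Vec (Fin m) r → ℕ → WSet m
B {r = r} zs k = record
  { Carrier = Σ (Vec ℕ r) (λ a → sum a ≡ k)
  ; weight  = λ { (a , _) → tupleWeight zs a } }

_⊗_ : ∀ {m} → WSet m → WSet m → WSet m
X ⊗ Y = record
  { Carrier = Carrier X × Carrier Y
  ; weight  = λ { (x , y) → weight X x · weight Y y } }

WBij : ∀ {m} → WSet m → WSet m → Set
WBij X Y = Σ (Carrier X ↔ Carrier Y)
             (λ f → ∀ p → weight Y (Inverse.to f p) ≡ weight X p)

-- Every element on either side has weight x^(j-q), so it suffices to match cardinalities.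
-- By stars and bars, B((x,…,x), n) with p+1 entries has C(p+n, p) elements, and the two
-- counts q·C(q+n, q) and (q+n)·C(q-1+n, q-1), with n = j-q, agree by the absorption identity.
module Submission where

open import Defs
open import Data.Nat using (ℕ; zero; suc; _+_; _*_; _≤_; _∸_; s≤s; z≤n)
open import Data.Nat.Properties
  using (+-identityʳ; +-suc; +-assoc; *-zeroʳ; *-identityˡ; *-identityʳ; *-distribˡ-+;
         ≡-irrelevant; m+n≡0⇒m≡0; m+n≡0⇒n≡0; suc-injective; m+[n∸m]≡n)
open import Data.Nat.Combinatorics using (_C_; nCn≡1; nC1≡n; nCk+nC[k+1]≡[n+1]C[k+1])
open import Data.Fin using (Fin; zero)
open import Data.Fin.Properties using (+↔⊎; *↔×)
open import Data.Vec using (Vec; []; _∷_; replicate; sum)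
open import Data.Product using (Σ; _×_; _,_)
open import Data.Product.Function.NonDependent.Propositional using (_×-↔_)
open import Data.Sum using (_⊎_; inj₁; inj₂)
open import Data.Sum.Function.Propositional using (_⊎-↔_)
open import Function.Bundles using (_↔_; Inverse; mk↔ₛ′)
open import Function.Properties.Inverse using (↔-refl; ↔-sym; ↔-trans)
open import Relation.Binary.PropositionalEquality
  using (_≡_; refl; sym; trans; cong; cong₂; subst; module ≡-Reasoning)

[k+1]*[n+1]C[k+1]≡[n+1]*nCk : ∀ n k → suc k * (suc n C suc k) ≡ suc n * (n C k)
[k+1]*[n+1]C[k+1]≡[n+1]*nCk zero    zero    = refl
[k+1]*[n+1]C[k+1]≡[n+1]*nCk zero    (suc k) = *-zeroʳ (suc (suc k))
[k+1]*[n+1]C[k+1]≡[n+1]*nCk (suc n) zero    =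
  trans (*-identityˡ _) (trans (nC1≡n (suc (suc n))) (sym (*-identityʳ _)))
[k+1]*[n+1]C[k+1]≡[n+1]*nCk (suc n) (suc k) = begin
  suc (suc k) * (suc (suc n) C suc (suc k))
    ≡⟨ cong (suc (suc k) *_) (nCk+nC[k+1]≡[n+1]C[k+1] (suc n) (suc k)) ⟨
  suc (suc k) * (N C suc k + N C suc (suc k))
    ≡⟨ *-distribˡ-+ (suc (suc k)) (N C suc k) _ ⟩
  (N C suc k + suc k * (N C suc k)) + suc (suc k) * (N C suc (suc k))
    ≡⟨ +-assoc (N C suc k) _ _ ⟩
  N C suc k + (suc k * (N C suc k) + suc (suc k) * (N C suc (suc k)))
    ≡⟨ cong (N C suc k +_) (cong₂ _+_ ([k+1]*[n+1]C[k+1]≡[n+1]*nCk n k)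
                                      ([k+1]*[n+1]C[k+1]≡[n+1]*nCk n (suc k))) ⟩
  N C suc k + (N * (n C k) + N * (n C suc k))
    ≡⟨ cong (N C suc k +_) (*-distribˡ-+ N (n C k) (n C suc k)) ⟨
  N C suc k + N * (n C k + n C suc k)
    ≡⟨ cong (λ c → N C suc k + N * c) (nCk+nC[k+1]≡[n+1]C[k+1] n k) ⟩
  suc N * (N C suc k) ∎
  where
  open ≡-Reasoning
  N = suc n

Composition : ℕ → ℕ → Set
Composition r n = Σ (Vec ℕ r) (λ a → sum a ≡ n)

composition-≡ : ∀ {r n} {a b : Vec ℕ r} (e : sum a ≡ n) (e′ : sum b ≡ n) →
                a ≡ b → _≡_ {A = Composition r n} (a , e) (b , e′)
composition-≡ e e′ refl = cong (_ ,_) (≡-irrelevant e e′)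

Composition[1,n]↔Fin1 : ∀ n → Composition 1 n ↔ Fin 1
Composition[1,n]↔Fin1 n =
  mk↔ₛ′ (λ _ → zero) (λ _ → n ∷ [] , +-identityʳ n) (λ { zero → refl })
  λ { (a ∷ [] , e) → composition-≡ _ e (cong (_∷ []) (trans (sym e) (+-identityʳ a))) }

sum≡0-unique : ∀ {r} (a b : Vec ℕ r) → sum a ≡ 0 → sum b ≡ 0 → a ≡ b
sum≡0-unique []      []      _  _  = refl
sum≡0-unique (x ∷ a) (y ∷ b) ea eb =
  cong₂ _∷_ (trans (m+n≡0⇒m≡0 x ea) (sym (m+n≡0⇒m≡0 y eb)))
            (sum≡0-unique a b (m+n≡0⇒n≡0 x ea) (m+n≡0⇒n≡0 y eb))

Composition[r,0]↔Fin1 : ∀ r → Composition r 0 ↔ Fin 1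
Composition[r,0]↔Fin1 r = mk↔ₛ′ (λ _ → zero) (λ _ → zeros r) (λ { zero → refl })
  λ { (a , e) → let (z , ez) = zeros r in composition-≡ ez e (sum≡0-unique z a ez e) }
  where
  zeros : ∀ r → Composition r 0
  zeros zero    = [] , refl
  zeros (suc r) with a , e ← zeros r = 0 ∷ a , e

Composition-split : ∀ p n →
  Composition (suc (suc p)) (suc n) ↔
  (Composition (suc p) (suc n) ⊎ Composition (suc (suc p)) n)
Composition-split p n = mk↔ₛ′ to from to∘from from∘to
  where
  Split = Composition (suc p) (suc n) ⊎ Composition (suc (suc p)) n
  to : Composition (suc (suc p)) (suc n) → Split
  to (zero  ∷ a , e) = inj₁ (a , e)
  to (suc x ∷ a , e) = inj₂ (x ∷ a , suc-injective e)
  from : Split → Composition (suc (suc p)) (suc n)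
  from (inj₁ (a , e))     = zero ∷ a , e
  from (inj₂ (x ∷ a , e)) = suc x ∷ a , cong suc e
  to∘from : ∀ c → to (from c) ≡ c
  to∘from (inj₁ _)           = refl
  to∘from (inj₂ (x ∷ a , e)) = cong inj₂ (composition-≡ _ e refl)
  from∘to : ∀ c → from (to c) ≡ c
  from∘to (zero  ∷ a , e) = refl
  from∘to (suc x ∷ a , e) = composition-≡ _ e refl

Fin-cong : ∀ {a b} → a ≡ b → Fin a ↔ Fin b
Fin-cong refl = ↔-refl

Composition↔Fin[p+n]Cp : ∀ p n → Composition (suc p) n ↔ Fin ((p + n) C p)
Composition↔Fin[p+n]Cp zero    n       = Composition[1,n]↔Fin1 n
Composition↔Fin[p+n]Cp (suc p) zero    =
  ↔-trans (Composition[r,0]↔Fin1 (suc (suc p)))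
          (Fin-cong (sym (trans (cong (_C suc p) (+-identityʳ (suc p))) (nCn≡1 (suc p)))))
Composition↔Fin[p+n]Cp (suc p) (suc n) =
  ↔-trans (Composition-split p n)
  (↔-trans (Composition↔Fin[p+n]Cp p (suc n) ⊎-↔ Composition↔Fin[p+n]Cp (suc p) n)
  (↔-trans (↔-sym +↔⊎)
           (Fin-cong pascal)))
  where
  pascal : (p + suc n) C p + suc (p + n) C suc p ≡ (suc p + suc n) C suc p
  pascal = subst (λ m → (p + suc n) C p + m C suc p ≡ (suc p + suc n) C suc p)
                 (+-suc p n) (nCk+nC[k+1]≡[n+1]C[k+1] (p + suc n) p)

HasWeight : ∀ {m} → WSet m → Mono m → Set
HasWeight X w = ∀ c → weight X c ≡ w

↔⇒WBij : ∀ {m} {X Y : WSet m} {w} →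
         HasWeight X w → HasWeight Y w → Carrier X ↔ Carrier Y → WBij X Y
↔⇒WBij wX wY f = f , λ c → trans (wY (Inverse.to f c)) (sym (wX c))

⊗-HasWeight : ∀ {m} {X Y : WSet m} {v w} →
              HasWeight X v → HasWeight Y w → HasWeight (X ⊗ Y) (v · w)
⊗-HasWeight wX wY (c , d) = cong₂ _·_ (wX c) (wY d)

tupleWeight-replicate : ∀ r (a : Vec ℕ r) → tupleWeight (replicate r (zero {0})) a ≡ sum a ∷ []
tupleWeight-replicate zero    []      = refl
tupleWeight-replicate (suc r) (x ∷ a) = cong (λ w → (x ∷ []) · w) (tupleWeight-replicate r a)

B-HasWeight : ∀ r n → HasWeight (B (replicate r (zero {0})) n) (n ∷ [])
B-HasWeight r n (a , e) = trans (tupleWeight-replicate r a) (cong (_∷ []) e)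

[k]⊗B-HasWeight : ∀ k r n → HasWeight ([ k ] ⊗ B (replicate r (zero {0})) n) (one · (n ∷ []))
[k]⊗B-HasWeight k r n = ⊗-HasWeight {X = [ k ]} (λ _ → refl) (B-HasWeight r n)

Fin×Composition-absorption : ∀ p n →
  (Fin (suc p) × Composition (suc (suc p)) n) ↔ (Fin (suc p + n) × Composition (suc p) n)
Fin×Composition-absorption p n =
  ↔-trans (↔-refl ×-↔ Composition↔Fin[p+n]Cp (suc p) n)
  (↔-trans (↔-sym *↔×)
  (↔-trans (Fin-cong ([k+1]*[n+1]C[k+1]≡[n+1]*nCk (p + n) p))
  (↔-trans *↔×
           (↔-refl ×-↔ ↔-sym (Composition↔Fin[p+n]Cp p n)))))

lemma2p10 : (q j : ℕ) → 1 ≤ q → q ≤ j →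
    WBij ([ q ] ⊗ B (replicate (suc q) (zero {0})) (j ∸ q))
         ([ j ] ⊗ B (replicate q (zero {0})) (j ∸ q))
lemma2p10 (suc p) j (s≤s z≤n) q≤j =
  subst (λ k → WBij ([ suc p ] ⊗ B (replicate (suc (suc p)) zero) n)
                     ([ k ] ⊗ B (replicate (suc p) zero) n))
        (m+[n∸m]≡n q≤j)
        (↔⇒WBij ([k]⊗B-HasWeight (suc p) (suc (suc p)) n)
                ([k]⊗B-HasWeight (suc p + n) (suc p) n)
                (Fin×Composition-absorption p n))
  where
  n = j ∸ suc p
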